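{- For any natural numbers $s,k,n$ the following hold: (1) $\mathcal M_{s,k,n+1}=\mathcal M_{s,k,n}+\mathcal M_{s-1,k,n}$; (2) $\mathcal M_{s,k+1,n}=s\,\mathcal M_{s,k,n}-n\,\mathcal M_{s-1,k,n-1}$, where $\mathcal M_{s,k,n}:=\mathcal F_{s,k}(n)$. Equivalently, as polynomial identities, $\mathcal F_{s,k}(x+1)=\mathcal F_{s,k}(x)+\mathcal F_{s-1,k}(x)$ and $\mathcal F_{s,k+1}(x)=s\,\mathcal F_{s,k}(x)-x\,\mathcal F_{s-1,k}(x-1)$.
   Context: For integers $s$ and natural $k$, the Moser polynomial is $\mathcal F_{s,k}(x)=\sum_{j=1}^{s}(-1)^{j-1}j^{k-1}\binom{x}{s-j}$, where $\binom{x}{m}=x(x-1)\cdots(x-m+1)/m!$ for $m\ge0$ and $\binom xm=0$ for $m<0$ (so $\mathcal F_{s,k}=0$ for $s\le0$). When $s,k\le n$, $\mathcal F_{s,k}(n)$ equals the coefficient of $\mathfrak p_k(A)$ when the power sum $\mathfrak p_k(A^{(s)})$ of the multiset $A^{(s)}$ of all $s$-element subsums of an arbitrary $n$-multiset $A$ of complex numbers is written (uniquely) as a polynomial in $\mathfrak p_1(A),\dots,\mathfrak p_k(A)$, where $\mathfrak p_j(A)=\sum_{a\in A}a^j$; the notation $\mathcal M_{s,k,n}$ stands for this number $\mathcal F_{s,k}(n)$. -}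

module Defs where

open import Data.Nat using (ℕ; zero; suc; _∸_) renaming (_^_ to _^ℕ_)
open import Data.Nat.Combinatorics using (_C_)
open import Data.Integer using (ℤ; +_; -[1+_]; _+_; _*_; _^_; 0ℤ)

sum1to : ℕ → (ℕ → ℤ) → ℤ
sum1to zero    f = 0ℤ
sum1to (suc m) f = sum1to m f + f (suc m)

-- Moser polynomial F_{s,k}(x) evaluated at a natural number x (s integer, k ≥ 1):
--   F_{s,k}(x) = Σ_{j=1}^{s} (-1)^{j-1} j^{k-1} binom(x, s-j),  and 0 for s ≤ 0.
-- For natural x and 0 ≤ m, binom(x,m) = x(x-1)…(x-m+1)/m! equals the stdlib x C m.
F : ℤ → ℕ → ℕ → ℤ
F (+ s)     k x = sum1to s (λ j → (-[1+ 0 ] ^ (j ∸ 1)) * + (j ^ℕ (k ∸ 1)) * + (x C (s ∸ j)))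
F -[1+ _ ]  k x = 0ℤ

M : ℤ → ℕ → ℕ → ℤ
M s k n = F s k n

module Submission where

-- Both recurrences for the Moser numbers hold for every "binomial convolution"
--   conv s g x = Σ_{j=1}^{s} g(j) · C(x, s-j),
-- whatever the coefficient sequence g, and F_{s,k} is the convolution with the
-- weights w_k(j) = (-1)^{j-1} j^{k-1}.
--   (1) Pascal's rule C(x+1, m+1) = C(x, m) + C(x, m+1), applied termwise (the
--       top term j = s has C(·, 0) = 1 and is unaffected), gives
--       conv s g (x+1) = conv s g x + conv (s-1) g x.
--   (2) Writing s = j + (s-j) and using the absorption identity
--       (m+1) · C(x, m+1) = x · C(x-1, m) on the second part gives
--       conv s (j ↦ j·g(j)) x = s · conv s g x - x · conv (s-1) g (x-1).
-- Since w_{k+1}(j) = j · w_k(j) for k ≥ 1, and F_{s-1,k} = conv (s-1) w_k also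
-- when s = 0 (both vanish), the proposition is (1) and (2) for g = w_k.

open import Defs
open import Data.Nat using (ℕ; suc; _≤_; _∸_)
open import Data.Integer using (ℤ; +_; _+_; _-_; _*_)
open import Data.Product using (_×_)
open import Relation.Binary.PropositionalEquality using (_≡_)

open import Data.Nat using (zero) renaming (_^_ to _^ℕ_)
import Data.Nat as ℕ
import Data.Nat.Properties as ℕP
open import Data.Nat.Combinatorics using (_C_; nC1≡n; nCk+nC[k+1]≡[n+1]C[k+1])
open import Data.Integer using (0ℤ; -[1+_]; _^_)
import Data.Integer.Properties as ℤP
open import Data.Product using (_,_)
open import Relation.Binary.PropositionalEquality
  using (refl; sym; trans; cong; cong₂; module ≡-Reasoning)
import Data.Integer.Solver as ℤSolver
import Data.Nat.Solver as ℕSolver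

open ≡-Reasoning

sum-cong : ∀ m {f g : ℕ → ℤ} → (∀ j → j ≤ m → f j ≡ g j) → sum1to m f ≡ sum1to m g
sum-cong zero    f≗g = refl
sum-cong (suc m) f≗g =
  cong₂ _+_ (sum-cong m (λ j j≤m → f≗g j (ℕP.m≤n⇒m≤1+n j≤m))) (f≗g (suc m) ℕP.≤-refl)

sum-+ : ∀ m (f g : ℕ → ℤ) → sum1to m (λ j → f j + g j) ≡ sum1to m f + sum1to m g
sum-+ zero    f g = refl
sum-+ (suc m) f g = begin
    sum1to m (λ j → f j + g j) + (f (suc m) + g (suc m))
  ≡⟨ cong (_+ (f (suc m) + g (suc m))) (sum-+ m f g) ⟩
    (sum1to m f + sum1to m g) + (f (suc m) + g (suc m))
  ≡⟨ solve 4 (λ a b c d → (a :+ b) :+ (c :+ d) := (a :+ c) :+ (b :+ d))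
       refl (sum1to m f) (sum1to m g) (f (suc m)) (g (suc m)) ⟩
    (sum1to m f + f (suc m)) + (sum1to m g + g (suc m))
  ∎
  where open ℤSolver.+-*-Solver

sum-* : ∀ m c (f : ℕ → ℤ) → sum1to m (λ j → c * f j) ≡ c * sum1to m f
sum-* zero    c f = sym (ℤP.*-zeroʳ c)
sum-* (suc m) c f = trans (cong (_+ c * f (suc m)) (sum-* m c f)) (sym (ℤP.*-distribˡ-+ c _ _))

absorption-suc : ∀ n m → suc m ℕ.* (suc n C suc m) ≡ suc n ℕ.* (n C m)
absorption-suc n       zero    =
  trans (ℕP.+-identityʳ _) (trans (nC1≡n (suc n)) (sym (ℕP.*-identityʳ (suc n))))
absorption-suc zero    (suc m) = ℕP.*-zeroʳ (suc (suc m))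
absorption-suc (suc n) (suc m) = begin
    suc (suc m) ℕ.* (suc (suc n) C suc (suc m))
  ≡⟨ cong (suc (suc m) ℕ.*_) (sym (nCk+nC[k+1]≡[n+1]C[k+1] (suc n) (suc m))) ⟩
    suc (suc m) ℕ.* (X ℕ.+ Y)
  ≡⟨ solve 3 (λ m X Y → (con 2 :+ m) :* (X :+ Y)
        := X :+ (con 1 :+ m) :* X :+ (con 2 :+ m) :* Y) refl m X Y ⟩
    X ℕ.+ suc m ℕ.* X ℕ.+ suc (suc m) ℕ.* Y
  ≡⟨ cong₂ (λ u v → X ℕ.+ u ℕ.+ v) (absorption-suc n m) (absorption-suc n (suc m)) ⟩
    X ℕ.+ suc n ℕ.* (n C m) ℕ.+ suc n ℕ.* (n C suc m)
  ≡⟨ solve 4 (λ n X a b → X :+ (con 1 :+ n) :* a :+ (con 1 :+ n) :* b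
        := X :+ (con 1 :+ n) :* (a :+ b)) refl n X (n C m) (n C suc m) ⟩
    X ℕ.+ suc n ℕ.* (n C m ℕ.+ n C suc m)
  ≡⟨ cong (λ u → X ℕ.+ suc n ℕ.* u) (nCk+nC[k+1]≡[n+1]C[k+1] n m) ⟩
    suc (suc n) ℕ.* X
  ∎
  where
  open ℕSolver.+-*-Solver
  X Y : ℕ
  X = suc n C suc m
  Y = suc n C suc (suc m)

absorption : ∀ n m → suc m ℕ.* (n C suc m) ≡ n ℕ.* ((n ∸ 1) C m)
absorption zero    m = ℕP.*-zeroʳ (suc m)
absorption (suc n) m = absorption-suc n m

conv : ℕ → (ℕ → ℤ) → ℕ → ℤ
conv s g x = sum1to s (λ j → g j * + (x C (s ∸ j)))

suc-∸ : ∀ s j → j ≤ s → suc s ∸ j ≡ suc (s ∸ j)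
suc-∸ s j j≤s = ℕP.+-∸-assoc 1 j≤s

conv-top : ∀ s g x →
  conv (suc s) g x ≡ sum1to s (λ j → g j * + (x C suc (s ∸ j))) + g (suc s)
conv-top s g x = cong₂ _+_
  (sum-cong s (λ j j≤s → cong (λ d → g j * + (x C d)) (suc-∸ s j j≤s)))
  (trans (cong (λ d → g (suc s) * + (x C d)) (ℕP.n∸n≡0 s)) (ℤP.*-identityʳ (g (suc s))))

conv-pascal : ∀ s g x → conv s g (suc x) ≡ conv s g x + conv (s ∸ 1) g x
conv-pascal zero    g x = refl
conv-pascal (suc s) g x = begin
    conv (suc s) g (suc x)
  ≡⟨ conv-top s g (suc x) ⟩
    sum1to s (λ j → g j * + (suc x C suc (s ∸ j))) + g (suc s)
  ≡⟨ cong (_+ g (suc s)) (sum-cong s (λ j _ → pascal-term j)) ⟩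
    sum1to s (λ j → lower j + upper j) + g (suc s)
  ≡⟨ cong (_+ g (suc s)) (sum-+ s lower upper) ⟩
    (conv s g x + sum1to s upper) + g (suc s)
  ≡⟨ ℤP.+-assoc (conv s g x) _ _ ⟩
    conv s g x + (sum1to s upper + g (suc s))
  ≡⟨ cong (_+_ (conv s g x)) (sym (conv-top s g x)) ⟩
    conv s g x + conv (suc s) g x
  ≡⟨ ℤP.+-comm (conv s g x) _ ⟩
    conv (suc s) g x + conv s g x
  ∎
  where
  lower upper : ℕ → ℤ
  lower j = g j * + (x C (s ∸ j))
  upper j = g j * + (x C suc (s ∸ j))
  pascal-term : ∀ j → g j * + (suc x C suc (s ∸ j)) ≡ lower j + upper j
  pascal-term j = begin
      g j * + (suc x C suc (s ∸ j))
    ≡⟨ cong (λ c → g j * + c) (sym (nCk+nC[k+1]≡[n+1]C[k+1] x (s ∸ j))) ⟩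
      g j * + (x C (s ∸ j) ℕ.+ x C suc (s ∸ j))
    ≡⟨ cong (g j *_) (ℤP.pos-+ (x C (s ∸ j)) _) ⟩
      g j * (+ (x C (s ∸ j)) + + (x C suc (s ∸ j)))
    ≡⟨ ℤP.*-distribˡ-+ (g j) _ _ ⟩
      lower j + upper j
    ∎

sum⇒difference : ∀ {a b c : ℤ} → a ≡ b + c → b ≡ a - c
sum⇒difference {a} {b} {c} a≡b+c = begin
    b
  ≡⟨ solve 2 (λ b c → b := (b :+ c) :- c) refl b c ⟩
    (b + c) - c
  ≡⟨ cong (_- c) (sym a≡b+c) ⟩
    a - c
  ∎
  where open ℤSolver.+-*-Solver

-- Weighting the terms of conv (s+1) g x by the offsets s+1-j and absorbing them
-- into the binomials yields x · conv s g (x-1); the top term has offset 0.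
conv-absorbed : ∀ s g x →
  sum1to (suc s) (λ j → g j * + ((suc s ∸ j) ℕ.* (x C (suc s ∸ j))))
    ≡ + x * conv s g (x ∸ 1)
conv-absorbed s g x = begin
    sum1to s absorbed + g (suc s) * + ((s ∸ s) ℕ.* (x C (s ∸ s)))
  ≡⟨ cong (_+_ (sum1to s absorbed)) top-vanishes ⟩
    sum1to s absorbed + 0ℤ
  ≡⟨ ℤP.+-identityʳ _ ⟩
    sum1to s absorbed
  ≡⟨ sum-cong s absorb-term ⟩
    sum1to s (λ j → + x * (g j * + ((x ∸ 1) C (s ∸ j))))
  ≡⟨ sum-* s (+ x) _ ⟩
    + x * conv s g (x ∸ 1)
  ∎
  where
  absorbed : ℕ → ℤ
  absorbed j = g j * + ((suc s ∸ j) ℕ.* (x C (suc s ∸ j)))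
  top-vanishes : g (suc s) * + ((s ∸ s) ℕ.* (x C (s ∸ s))) ≡ 0ℤ
  top-vanishes = trans (cong (λ d → g (suc s) * + (d ℕ.* (x C d))) (ℕP.n∸n≡0 s))
                       (ℤP.*-zeroʳ (g (suc s)))
  absorb-term : ∀ j → j ≤ s → absorbed j ≡ + x * (g j * + ((x ∸ 1) C (s ∸ j)))
  absorb-term j j≤s = begin
      g j * + ((suc s ∸ j) ℕ.* (x C (suc s ∸ j)))
    ≡⟨ cong (λ d → g j * + (d ℕ.* (x C d))) (suc-∸ s j j≤s) ⟩
      g j * + (suc (s ∸ j) ℕ.* (x C suc (s ∸ j)))
    ≡⟨ cong (λ c → g j * + c) (absorption x (s ∸ j)) ⟩
      g j * + (x ℕ.* ((x ∸ 1) C (s ∸ j)))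
    ≡⟨ cong (g j *_) (ℤP.pos-* x _) ⟩
      g j * (+ x * + ((x ∸ 1) C (s ∸ j)))
    ≡⟨ solve 3 (λ g x c → g :* (x :* c) := x :* (g :* c)) refl (g j) (+ x) _ ⟩
      + x * (g j * + ((x ∸ 1) C (s ∸ j)))
    ∎
    where open ℤSolver.+-*-Solver

-- Recurrence (2): weighting the coefficients by their index j = s - (s-j) and
-- absorbing the offsets s-j into the binomials.
conv-index-weighted : ∀ s g x →
  conv s (λ j → + j * g j) x ≡ + s * conv s g x - + x * conv (s ∸ 1) g (x ∸ 1)
conv-index-weighted zero    g x = cong (0ℤ -_) (sym (ℤP.*-zeroʳ (+ x)))
conv-index-weighted (suc s) g x = sum⇒difference (begin
    + suc s * conv (suc s) g x
  ≡⟨ sym (sum-* (suc s) (+ suc s) _) ⟩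
    sum1to (suc s) (λ j → + suc s * term j)
  ≡⟨ sum-cong (suc s) split-term ⟩
    sum1to (suc s) (λ j → weighted j + absorbed j)
  ≡⟨ sum-+ (suc s) weighted absorbed ⟩
    conv (suc s) (λ j → + j * g j) x + sum1to (suc s) absorbed
  ≡⟨ cong (_+_ (conv (suc s) (λ j → + j * g j) x)) (conv-absorbed s g x) ⟩
    conv (suc s) (λ j → + j * g j) x + + x * conv s g (x ∸ 1)
  ∎)
  where
  term weighted absorbed : ℕ → ℤ
  term     j = g j * + (x C (suc s ∸ j))
  weighted j = + j * g j * + (x C (suc s ∸ j))
  absorbed j = g j * + ((suc s ∸ j) ℕ.* (x C (suc s ∸ j)))
  split-term : ∀ j → j ≤ suc s → + suc s * term j ≡ weighted j + absorbed j
  split-term j j≤s+1 = begin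
      + suc s * (g j * + c)
    ≡⟨ cong (_* (g j * + c)) (trans (sym (ℤP.pos-+ j d)) (cong +_ (ℕP.m+[n∸m]≡n j≤s+1))) ⟨
      (+ j + + d) * (g j * + c)
    ≡⟨ solve 4 (λ g c j d → (j :+ d) :* (g :* c) := j :* g :* c :+ g :* (d :* c))
         refl (g j) (+ c) (+ j) (+ d) ⟩
      + j * g j * + c + g j * (+ d * + c)
    ≡⟨ cong (λ dc → weighted j + g j * dc) (ℤP.pos-* d c) ⟨
      weighted j + absorbed j
    ∎
    where
    open ℤSolver.+-*-Solver
    d c : ℕ
    d = suc s ∸ j
    c = x C d

moserWeight : ℕ → ℕ → ℤ
moserWeight k j = -[1+ 0 ] ^ (j ∸ 1) * + (j ^ℕ (k ∸ 1))

moserWeight-suc : ∀ k j → moserWeight (suc (suc k)) j ≡ + j * moserWeight (suc k) j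
moserWeight-suc k j = begin
    σ * + (j ℕ.* j ^ℕ k)
  ≡⟨ cong (σ *_) (ℤP.pos-* j (j ^ℕ k)) ⟩
    σ * (+ j * + (j ^ℕ k))
  ≡⟨ solve 3 (λ σ j p → σ :* (j :* p) := j :* (σ :* p)) refl σ (+ j) (+ (j ^ℕ k)) ⟩
    + j * (σ * + (j ^ℕ k))
  ∎
  where
  open ℤSolver.+-*-Solver
  σ : ℤ
  σ = -[1+ 0 ] ^ (j ∸ 1)

F-pred : ∀ s k x → F (+ s - + 1) k x ≡ conv (s ∸ 1) (moserWeight k) x
F-pred zero    k x = refl
F-pred (suc s) k x = refl

proposition3p7 : (s k n : ℕ) → 1 ≤ k →
    (M (+ s) k (suc n) ≡ M (+ s) k n + M (+ s - + 1) k n)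
    × (M (+ s) (suc k) n ≡ + s * M (+ s) k n - + n * M (+ s - + 1) k (n ∸ 1))
proposition3p7 s (suc k) n _ = pascal , index-recurrence
  where
  w : ℕ → ℤ
  w = moserWeight (suc k)
  pascal : F (+ s) (suc k) (suc n) ≡ F (+ s) (suc k) n + F (+ s - + 1) (suc k) n
  pascal = begin
      conv s w (suc n)
    ≡⟨ conv-pascal s w n ⟩
      conv s w n + conv (s ∸ 1) w n
    ≡⟨ cong (_+_ (conv s w n)) (F-pred s (suc k) n) ⟨
      F (+ s) (suc k) n + F (+ s - + 1) (suc k) n
    ∎
  index-recurrence : F (+ s) (suc (suc k)) n
    ≡ + s * F (+ s) (suc k) n - + n * F (+ s - + 1) (suc k) (n ∸ 1)
  index-recurrence = begin
      conv s (moserWeight (suc (suc k))) n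
    ≡⟨ sum-cong s (λ j _ → cong (_* + (n C (s ∸ j))) (moserWeight-suc k j)) ⟩
      conv s (λ j → + j * w j) n
    ≡⟨ conv-index-weighted s w n ⟩
      + s * conv s w n - + n * conv (s ∸ 1) w (n ∸ 1)
    ≡⟨ cong (λ f → + s * conv s w n - + n * f) (F-pred s (suc k) (n ∸ 1)) ⟨
      + s * F (+ s) (suc k) n - + n * F (+ s - + 1) (suc k) (n ∸ 1)
    ∎
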